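{- Let $n>1$ be an integer and let $G_n(y):=y\cdot T_n\big(\frac1{2y}\big)/T_{n-1}\big(\frac1{2y}\big)$, expanded as a formal power series in $y$. Let $G(y)$ be the formal power series given by the infinite continued fraction $$G(y) = 1 - \cfrac{y^2}{1 - \cfrac{y^2}{1-\cfrac{y^2}{1 - \ldots}}}.$$ Then $G(y)$ and $G_n(y)$ have the same coefficients of $y^j$ for all $0\le j\le 2n-4$.
   Context: For $n\ge1$, $T_n(x)$ is the Chebyshev polynomial of the first kind: $T_n(\cos t)=\cos(nt)$; equivalently $T_1(x)=x$, $T_2(x)=2x^2-1$, $T_{n+1}(x)=2xT_n(x)-T_{n-1}(x)$. The infinite continued fraction is defined as a formal power series as follows: let $D_0(y)=1$ and $D_{m+1}(y)=1-y^2/D_m(y)$ (quotients of formal power series with constant term $1$ in the denominator). For each $j$, the coefficient of $y^j$ in $D_m(y)$ is the same for all sufficiently large $m$ (indeed $D_m$ and $D_{m+1}$ agree up to $y^{2m}$), and $G(y)$ is the formal power series whose coefficients are these stabilized values. -}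

module Defs where

open import Data.Nat as ℕ using (ℕ; zero; suc; _∸_; _≤?_)
open import Data.Rational using (ℚ; 0ℚ; 1ℚ; _+_; _*_; _-_; 1/_; ≢-nonZero; _/_)
open import Data.Rational.Properties using (_≟_)
open import Data.Integer using (+_)
open import Data.List using (List; map; foldr; upTo)
open import Relation.Nullary using (yes; no)

-- Formal power series over ℚ, as coefficient sequences:  f k = [y^k] f.

Series : Set
Series = ℕ → ℚ

sumℚ : List ℚ → ℚ
sumℚ = foldr _+_ 0ℚ

zeroS : Series
zeroS _ = 0ℚ

oneS : Series
oneS zero    = 1ℚ
oneS (suc _) = 0ℚ

y² : Series
y² 2 = 1ℚ
y² _ = 0ℚ

_-S_ : Series → Series → Series
(f -S g) k = f k - g k

_*S_ : Series → Series → Series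
(f *S g) k = sumℚ (map (λ i → f i * g (k ∸ i)) (upTo (suc k)))

-- multiplicative inverse of a rational (junk value 0 at 0)
invℚ : ℚ → ℚ
invℚ q with q ≟ 0ℚ
... | yes _  = 0ℚ
... | no q≢0 = 1/_ q {{≢-nonZero q≢0}}

-- Quotient f / g of formal power series (meaningful when g 0 ≠ 0):
-- the unique q with g * q = f, computed coefficientwise by
--   q_k = (f_k - Σ_{i=1}^{k} g_i q_{k-i}) / g_0 .
-- divPre f g k j = q_j for all j ≤ k.
divPre : Series → Series → ℕ → ℕ → ℚ
divPre f g zero    _ = f 0 * invℚ (g 0)
divPre f g (suc k) j with j ≤? k
... | yes _ = divPre f g k j
... | no  _ = (f (suc k) - sumℚ (map (λ i → g (suc i) * divPre f g k (k ∸ i)) (upTo (suc k))))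
              * invℚ (g 0)

_/S_ : Series → Series → Series
(f /S g) k = divPre f g k k

-- Chebyshev polynomials of the first kind, as coefficient sequences
-- Tpoly n k = coefficient of x^k in T_n(x);
-- T_0 = 1, T_1 = x, T_{n+2} = 2x T_{n+1} - T_n.

xshift : (ℕ → ℚ) → (ℕ → ℚ)
xshift p zero    = 0ℚ
xshift p (suc k) = p k

Tpoly : ℕ → ℕ → ℚ
Tpoly zero          = oneS
Tpoly (suc zero)    = xshift oneS
Tpoly (suc (suc n)) k = (+ 2 / 1) * xshift (Tpoly (suc n)) k - Tpoly n k

-- For a polynomial p of degree ≤ d, the polynomial  y^d · p(1/(2y))  in y:
-- its coefficient of y^i is p_{d-i} / 2^{d-i} for i ≤ d, and 0 otherwise.
pow2inv : ℕ → ℚ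
pow2inv zero    = 1ℚ
pow2inv (suc m) = (+ 1 / 2) * pow2inv m

substRecip : ℕ → (ℕ → ℚ) → Series
substRecip d p i with i ≤? d
... | yes _ = p (d ∸ i) * pow2inv (d ∸ i)
... | no  _ = 0ℚ

-- G_n(y) = y · T_n(1/(2y)) / T_{n-1}(1/(2y))
--        = (y^n T_n(1/(2y))) / (y^{n-1} T_{n-1}(1/(2y)))   (multiply top and bottom by y^{n-1}),
-- a quotient of two polynomials in y, expanded as a formal power series.
Gn : ℕ → Series
Gn n = substRecip n (Tpoly n) /S substRecip (n ∸ 1) (Tpoly (n ∸ 1))

-- The continued fraction:  D_0 = 1,  D_{m+1} = 1 - y^2 / D_m,
-- and G(y) has as coefficient of y^j the stabilised value of [y^j] D_m.
-- Since D_m and D_{m+1} agree up to y^{2m}, [y^j] D_m is stable for m ≥ j,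
-- so we take [y^j] G = [y^j] D_{j+1}.

D : ℕ → Series
D zero    = oneS
D (suc m) = oneS -S (y² /S D m)

G : Series
G j = D (suc j) j

-- Write Tʳ n := y^n T_n(1/(2y)).  The Chebyshev recurrence becomes
-- Tʳ (n+2) = Tʳ (n+1) - y² Tʳ n, hence G_(n+2) = 1 - y²/G_(n+1): the G_n, like
-- the D_m, are iterates of the map cf Q = 1 - y²/Q.  This map gains two orders
-- of agreement (if Q and Q' agree through y^k, then cf Q and cf Q' agree
-- through y^(k+2)), and G_2, D_0, D_1 all have constant term 1.  So G_(m+2)
-- agrees with D_(m+1), and D_m with every later D_m', through y^(2m).

module Submission where

open import Defs
open import Data.Nat using (ℕ; _<_; _≤_; _*_; _∸_)
open import Relation.Binary.PropositionalEquality using (_≡_)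

open import Data.Nat using (zero; suc; z≤n; s≤s; _≤?_; _≤′_; ≤′-refl; ≤′-step)
  renaming (_+_ to _+ℕ_)
import Data.Nat.Properties as ℕ
open import Data.Rational using (ℚ; 0ℚ; 1ℚ; ½; _/_; ≢-nonZero)
  renaming (_+_ to _+ℚ_; _*_ to _*ℚ_; _-_ to _-ℚ_)
import Data.Rational.Properties as ℚ
open import Data.Rational.Solver using (module +-*-Solver)
open import Data.Integer using (+_)
open import Data.List using (map; upTo; applyUpTo)
import Data.List.Properties as List
open import Data.Sum using (inj₁; inj₂)
open import Data.Empty using (⊥-elim)
open import Function using (_∘_; id)
open import Relation.Binary.PropositionalEquality
  using (refl; sym; trans; cong; cong₂; subst; _≗_; _≢_; module ≡-Reasoning)
open import Relation.Nullary using (yes; no)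
open import Algebra.Properties.Group ℚ.+-0-group using (x≈z//y; //-rightDividesˡ)
open +-*-Solver using (solve; _:+_; _:*_; _:-_; _:=_)

*-invℚʳ : ∀ {a} → a ≢ 0ℚ → a *ℚ invℚ a ≡ 1ℚ
*-invℚʳ {a} a≢0 with a ℚ.≟ 0ℚ
... | yes a≡0 = ⊥-elim (a≢0 a≡0)
... | no  a≢0 = ℚ.*-inverseʳ a {{≢-nonZero a≢0}}

*-invℚ-cancelˡ : ∀ {a} s → a ≢ 0ℚ → a *ℚ (s *ℚ invℚ a) ≡ s
*-invℚ-cancelˡ {a} s a≢0 = begin
  a *ℚ (s *ℚ invℚ a)   ≡⟨ swap a s (invℚ a) ⟩
  s *ℚ (a *ℚ invℚ a)   ≡⟨ cong (s *ℚ_) (*-invℚʳ a≢0) ⟩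
  s *ℚ 1ℚ              ≡⟨ ℚ.*-identityʳ s ⟩
  s                    ∎
  where
  open ≡-Reasoning
  swap : ∀ a s i → a *ℚ (s *ℚ i) ≡ s *ℚ (a *ℚ i)
  swap = solve 3 (λ a s i → a :* (s :* i) := s :* (a :* i)) refl

*-invℚ-solve : ∀ {a x s} → a ≢ 0ℚ → a *ℚ x ≡ s → x ≡ s *ℚ invℚ a
*-invℚ-solve {a} {x} {s} a≢0 ax≡s = begin
  x                     ≡⟨ ℚ.*-identityʳ x ⟨
  x *ℚ 1ℚ               ≡⟨ cong (x *ℚ_) (*-invℚʳ a≢0) ⟨
  x *ℚ (a *ℚ invℚ a)    ≡⟨ swap x a (invℚ a) ⟩
  (a *ℚ x) *ℚ invℚ a    ≡⟨ cong (_*ℚ invℚ a) ax≡s ⟩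
  s *ℚ invℚ a           ∎
  where
  open ≡-Reasoning
  swap : ∀ x a i → x *ℚ (a *ℚ i) ≡ (a *ℚ x) *ℚ i
  swap = solve 3 (λ x a i → x :* (a :* i) := (a :* x) :* i) refl

infix 4 _≈[_]_
_≈[_]_ : Series → ℕ → Series → Set
f ≈[ k ] g = ∀ i → i ≤ k → f i ≡ g i

≈-weaken : ∀ {f g j k} → j ≤ k → f ≈[ k ] g → f ≈[ j ] g
≈-weaken j≤k f≈g i i≤j = f≈g i (ℕ.≤-trans i≤j j≤k)

≈-extend : ∀ {f g k} → f ≈[ k ] g → f (suc k) ≡ g (suc k) → f ≈[ suc k ] g
≈-extend f≈g top i i≤1+k with ℕ.m≤n⇒m<n∨m≡n i≤1+k
... | inj₁ (s≤s i≤k) = f≈g i i≤k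
... | inj₂ refl      = top

tailS : Series → Series
tailS f i = f (suc i)

infixl 6 _+S_
_+S_ : Series → Series → Series
(f +S g) i = f i +ℚ g i

infixr 7 _·S_
_·S_ : ℚ → Series → Series
(c ·S f) i = c *ℚ f i

infixr 25 y²·_
y²·_ : Series → Series
(y²· f) zero          = 0ℚ
(y²· f) (suc zero)    = 0ℚ
(y²· f) (suc (suc i)) = f i

y²·-cong : ∀ {f g} → f ≗ g → y²· f ≗ y²· g
y²·-cong f≗g zero          = refl
y²·-cong f≗g (suc zero)    = refl
y²·-cong f≗g (suc (suc i)) = f≗g i

y²·-cong-≈ : ∀ {f g k} → f ≈[ k ] g → y²· f ≈[ 2 +ℕ k ] y²· g
y²·-cong-≈ f≈g zero          _                 = refl
y²·-cong-≈ f≈g (suc zero)    _                 = refl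
y²·-cong-≈ f≈g (suc (suc i)) (s≤s (s≤s i≤k)) = f≈g i i≤k

y²≗y²·oneS : y² ≗ y²· oneS
y²≗y²·oneS zero                = refl
y²≗y²·oneS (suc zero)          = refl
y²≗y²·oneS (suc (suc zero))    = refl
y²≗y²·oneS (suc (suc (suc i))) = refl

-- The Cauchy product _*S_ in a form suited to induction on the index (see *S≗⋆).
infixl 7 _⋆_
_⋆_ : Series → Series → Series
(f ⋆ g) zero    = f 0 *ℚ g 0
(f ⋆ g) (suc k) = f 0 *ℚ g (suc k) +ℚ (tailS f ⋆ g) k

sum-upTo-suc : ∀ (h : ℕ → ℚ) n →
  sumℚ (map h (upTo (suc n))) ≡ h 0 +ℚ sumℚ (map (h ∘ suc) (upTo n))
sum-upTo-suc h n = cong (λ xs → h 0 +ℚ sumℚ xs) (begin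
  map h (applyUpTo suc n)   ≡⟨ List.map-applyUpTo suc h n ⟩
  applyUpTo (h ∘ suc) n     ≡⟨ List.map-applyUpTo id (h ∘ suc) n ⟨
  map (h ∘ suc) (upTo n)    ∎)
  where open ≡-Reasoning

*S≗⋆ : ∀ f g → f *S g ≗ f ⋆ g
*S≗⋆ f g zero    = ℚ.+-identityʳ (f 0 *ℚ g 0)
*S≗⋆ f g (suc k) = trans (sum-upTo-suc (λ i → f i *ℚ g (suc k ∸ i)) (suc k))
                         (cong (f 0 *ℚ g (suc k) +ℚ_) (*S≗⋆ (tailS f) g k))

⋆-cong-≈ : ∀ {f f' g g' k} → f ≈[ k ] f' → g ≈[ k ] g' → f ⋆ g ≈[ k ] f' ⋆ g'
⋆-cong-≈ f≈f' g≈g' zero _ = cong₂ _*ℚ_ (f≈f' 0 z≤n) (g≈g' 0 z≤n)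
⋆-cong-≈ {k = suc k} f≈f' g≈g' (suc i) (s≤s i≤k) =
  cong₂ _+ℚ_ (cong₂ _*ℚ_ (f≈f' 0 z≤n) (g≈g' (suc i) (s≤s i≤k)))
             (⋆-cong-≈ (λ j j≤k → f≈f' (suc j) (s≤s j≤k))
                       (≈-weaken (ℕ.n≤1+n k) g≈g') i i≤k)

⋆-cong : ∀ {f f' g g'} → f ≗ f' → g ≗ g' → f ⋆ g ≗ f' ⋆ g'
⋆-cong f≗f' g≗g' i = ⋆-cong-≈ {k = i} (λ j _ → f≗f' j) (λ j _ → g≗g' j) i ℕ.≤-refl

⋆-distribʳ-+S : ∀ f g h → (f +S g) ⋆ h ≗ f ⋆ h +S g ⋆ h
⋆-distribʳ-+S f g h zero    = ℚ.*-distribʳ-+ (h 0) (f 0) (g 0)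
⋆-distribʳ-+S f g h (suc k) = begin
  (f 0 +ℚ g 0) *ℚ h (suc k) +ℚ ((tailS f +S tailS g) ⋆ h) k
    ≡⟨ cong ((f 0 +ℚ g 0) *ℚ h (suc k) +ℚ_) (⋆-distribʳ-+S (tailS f) (tailS g) h k) ⟩
  (f 0 +ℚ g 0) *ℚ h (suc k) +ℚ ((tailS f ⋆ h) k +ℚ (tailS g ⋆ h) k)
    ≡⟨ rearrange (f 0) (g 0) (h (suc k)) ((tailS f ⋆ h) k) ((tailS g ⋆ h) k) ⟩
  (f 0 *ℚ h (suc k) +ℚ (tailS f ⋆ h) k) +ℚ (g 0 *ℚ h (suc k) +ℚ (tailS g ⋆ h) k) ∎
  where
  open ≡-Reasoning
  rearrange : ∀ a b c x y → (a +ℚ b) *ℚ c +ℚ (x +ℚ y) ≡ (a *ℚ c +ℚ x) +ℚ (b *ℚ c +ℚ y)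
  rearrange = solve 5 (λ a b c x y → (a :+ b) :* c :+ (x :+ y) := (a :* c :+ x) :+ (b :* c :+ y)) refl

⋆-·S : ∀ c f h → (c ·S f) ⋆ h ≗ c ·S (f ⋆ h)
⋆-·S c f h zero    = ℚ.*-assoc c (f 0) (h 0)
⋆-·S c f h (suc k) = begin
  (c *ℚ f 0) *ℚ h (suc k) +ℚ ((c ·S tailS f) ⋆ h) k
    ≡⟨ cong ((c *ℚ f 0) *ℚ h (suc k) +ℚ_) (⋆-·S c (tailS f) h k) ⟩
  (c *ℚ f 0) *ℚ h (suc k) +ℚ c *ℚ (tailS f ⋆ h) k
    ≡⟨ factor c (f 0) (h (suc k)) ((tailS f ⋆ h) k) ⟩
  c *ℚ (f 0 *ℚ h (suc k) +ℚ (tailS f ⋆ h) k) ∎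
  where
  open ≡-Reasoning
  factor : ∀ c a b x → (c *ℚ a) *ℚ b +ℚ c *ℚ x ≡ c *ℚ (a *ℚ b +ℚ x)
  factor = solve 4 (λ c a b x → (c :* a) :* b :+ c :* x := c :* (a :* b :+ x)) refl

-- tailS (f ⋆ g) is definitionally f 0 ·S tailS g +S tailS f ⋆ g.
⋆-assoc : ∀ f g h → (f ⋆ g) ⋆ h ≗ f ⋆ (g ⋆ h)
⋆-assoc f g h zero    = ℚ.*-assoc (f 0) (g 0) (h 0)
⋆-assoc f g h (suc k) = begin
  (f 0 *ℚ g 0) *ℚ h (suc k) +ℚ ((f 0 ·S tailS g +S tailS f ⋆ g) ⋆ h) k
    ≡⟨ cong ((f 0 *ℚ g 0) *ℚ h (suc k) +ℚ_) (⋆-distribʳ-+S (f 0 ·S tailS g) (tailS f ⋆ g) h k) ⟩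
  (f 0 *ℚ g 0) *ℚ h (suc k) +ℚ (((f 0 ·S tailS g) ⋆ h) k +ℚ ((tailS f ⋆ g) ⋆ h) k)
    ≡⟨ cong₂ (λ u v → (f 0 *ℚ g 0) *ℚ h (suc k) +ℚ (u +ℚ v))
             (⋆-·S (f 0) (tailS g) h k) (⋆-assoc (tailS f) g h k) ⟩
  (f 0 *ℚ g 0) *ℚ h (suc k) +ℚ (f 0 *ℚ (tailS g ⋆ h) k +ℚ (tailS f ⋆ (g ⋆ h)) k)
    ≡⟨ factor (f 0) (g 0) (h (suc k)) ((tailS g ⋆ h) k) ((tailS f ⋆ (g ⋆ h)) k) ⟩
  f 0 *ℚ (g 0 *ℚ h (suc k) +ℚ (tailS g ⋆ h) k) +ℚ (tailS f ⋆ (g ⋆ h)) k ∎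
  where
  open ≡-Reasoning
  factor : ∀ a b c x y → (a *ℚ b) *ℚ c +ℚ (a *ℚ x +ℚ y) ≡ a *ℚ (b *ℚ c +ℚ x) +ℚ y
  factor = solve 5 (λ a b c x y → (a :* b) :* c :+ (a :* x :+ y) := a :* (b :* c :+ x) :+ y) refl

⋆-distribˡ--S : ∀ f g h → f ⋆ (g -S h) ≗ (f ⋆ g) -S (f ⋆ h)
⋆-distribˡ--S f g h zero    = distrib (f 0) (g 0) (h 0)
  where
  distrib : ∀ a b c → a *ℚ (b -ℚ c) ≡ a *ℚ b -ℚ a *ℚ c
  distrib = solve 3 (λ a b c → a :* (b :- c) := a :* b :- a :* c) refl
⋆-distribˡ--S f g h (suc k) =
  trans (cong (f 0 *ℚ (g (suc k) -ℚ h (suc k)) +ℚ_) (⋆-distribˡ--S (tailS f) g h k))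
        (rearrange (f 0) (g (suc k)) (h (suc k)) ((tailS f ⋆ g) k) ((tailS f ⋆ h) k))
  where
  rearrange : ∀ a b c x y → a *ℚ (b -ℚ c) +ℚ (x -ℚ y) ≡ (a *ℚ b +ℚ x) -ℚ (a *ℚ c +ℚ y)
  rearrange = solve 5 (λ a b c x y → a :* (b :- c) :+ (x :- y) := (a :* b :+ x) :- (a :* c :+ y)) refl

⋆-identityʳ : ∀ f → f ⋆ oneS ≗ f
⋆-identityʳ f zero    = ℚ.*-identityʳ (f 0)
⋆-identityʳ f (suc k) =
  trans (cong₂ _+ℚ_ (ℚ.*-zeroʳ (f 0)) (⋆-identityʳ (tailS f) k)) (ℚ.+-identityˡ (f (suc k)))

⋆-y²· : ∀ f g → f ⋆ (y²· g) ≗ y²· (f ⋆ g)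
⋆-y²· f g zero                = ℚ.*-zeroʳ (f 0)
⋆-y²· f g (suc zero)          = cong₂ _+ℚ_ (ℚ.*-zeroʳ (f 0)) (⋆-y²· (tailS f) g 0)
⋆-y²· f g (suc (suc zero))    =
  trans (cong (f 0 *ℚ g 0 +ℚ_) (⋆-y²· (tailS f) g 1)) (ℚ.+-identityʳ (f 0 *ℚ g 0))
⋆-y²· f g (suc (suc (suc k))) = cong (f 0 *ℚ g (suc k) +ℚ_) (⋆-y²· (tailS f) g (suc (suc k)))

⋆-y² : ∀ f → f ⋆ y² ≗ y²· f
⋆-y² f i = begin
  (f ⋆ y²) i           ≡⟨ ⋆-cong (λ _ → refl) y²≗y²·oneS i ⟩
  (f ⋆ y²· oneS) i     ≡⟨ ⋆-y²· f oneS i ⟩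
  (y²· (f ⋆ oneS)) i   ≡⟨ y²·-cong (⋆-identityʳ f) i ⟩
  (y²· f) i            ∎
  where open ≡-Reasoning

divPre-step : ∀ f g {k j} → j ≤ k → divPre f g (suc k) j ≡ divPre f g k j
divPre-step f g {k} {j} j≤k with j ≤? k
... | yes _  = refl
... | no j≰k = ⊥-elim (j≰k j≤k)

divPre-stable : ∀ f g k → divPre f g k ≈[ k ] f /S g
divPre-stable f g zero    zero z≤n = refl
divPre-stable f g (suc k) =
  ≈-extend (λ j j≤k → trans (divPre-step f g j≤k) (divPre-stable f g k j j≤k)) refl

/S-suc : ∀ f g k → (f /S g) (suc k) ≡ (f (suc k) -ℚ (tailS g ⋆ (f /S g)) k) *ℚ invℚ (g 0)
/S-suc f g k with suc k ≤? k
... | yes 1+k≤k = ⊥-elim (ℕ.<-irrefl refl 1+k≤k)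
... | no _      = cong (λ r → (f (suc k) -ℚ r) *ℚ invℚ (g 0)) (begin
  (tailS g *S divPre f g k) k   ≡⟨ *S≗⋆ (tailS g) (divPre f g k) k ⟩
  (tailS g ⋆ divPre f g k) k    ≡⟨ ⋆-cong-≈ (λ _ _ → refl) (divPre-stable f g k) k ℕ.≤-refl ⟩
  (tailS g ⋆ (f /S g)) k        ∎)
  where open ≡-Reasoning

g⋆[f/g]≗f : ∀ f g → g 0 ≢ 0ℚ → g ⋆ (f /S g) ≗ f
g⋆[f/g]≗f f g g0≢0 zero    = *-invℚ-cancelˡ (f 0) g0≢0
g⋆[f/g]≗f f g g0≢0 (suc k) = begin
  g 0 *ℚ (f /S g) (suc k) +ℚ r                 ≡⟨ cong (λ x → g 0 *ℚ x +ℚ r) (/S-suc f g k) ⟩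
  g 0 *ℚ ((f (suc k) -ℚ r) *ℚ invℚ (g 0)) +ℚ r ≡⟨ cong (_+ℚ r) (*-invℚ-cancelˡ (f (suc k) -ℚ r) g0≢0) ⟩
  (f (suc k) -ℚ r) +ℚ r                        ≡⟨ //-rightDividesˡ r (f (suc k)) ⟩
  f (suc k)                                     ∎
  where
  open ≡-Reasoning
  r = (tailS g ⋆ (f /S g)) k

/S-unique-≈ : ∀ {f g q k} → g 0 ≢ 0ℚ → g ⋆ q ≈[ k ] f → q ≈[ k ] f /S g
/S-unique-≈ g0≢0 gq≈f zero z≤n = *-invℚ-solve g0≢0 (gq≈f 0 z≤n)
/S-unique-≈ {f} {g} {q} {suc k} g0≢0 gq≈f = ≈-extend q≈f/g (begin
  q (suc k)                                            ≡⟨ *-invℚ-solve g0≢0 g0q≡f-r ⟩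
  (f (suc k) -ℚ (tailS g ⋆ q) k) *ℚ invℚ (g 0)         ≡⟨ cong (λ r → (f (suc k) -ℚ r) *ℚ invℚ (g 0))
                                                             (⋆-cong-≈ (λ _ _ → refl) q≈f/g k ℕ.≤-refl) ⟩
  (f (suc k) -ℚ (tailS g ⋆ (f /S g)) k) *ℚ invℚ (g 0)  ≡⟨ /S-suc f g k ⟨
  (f /S g) (suc k)                                     ∎)
  where
  open ≡-Reasoning
  q≈f/g : q ≈[ k ] f /S g
  q≈f/g = /S-unique-≈ g0≢0 (≈-weaken (ℕ.n≤1+n k) gq≈f)
  g0q≡f-r : g 0 *ℚ q (suc k) ≡ f (suc k) -ℚ (tailS g ⋆ q) k
  g0q≡f-r = x≈z//y _ _ _ (gq≈f (suc k) ℕ.≤-refl)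

/S-unique : ∀ {f g q} → g 0 ≢ 0ℚ → g ⋆ q ≗ f → q ≗ f /S g
/S-unique g0≢0 gq≗f i = /S-unique-≈ {k = i} g0≢0 (λ j _ → gq≗f j) i ℕ.≤-refl

/S-cong-≈ : ∀ {f f' g g' k} → g 0 ≢ 0ℚ → f ≈[ k ] f' → g ≈[ k ] g' → f /S g ≈[ k ] f' /S g'
/S-cong-≈ {f} {f'} {g} {g'} g0≢0 f≈f' g≈g' = /S-unique-≈ g'0≢0 g'⋆[f/g]≈f'
  where
  g'0≢0 : g' 0 ≢ 0ℚ
  g'0≢0 = g0≢0 ∘ trans (g≈g' 0 z≤n)
  g'⋆[f/g]≈f' : g' ⋆ (f /S g) ≈[ _ ] f'
  g'⋆[f/g]≈f' i i≤k = begin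
    (g' ⋆ (f /S g)) i  ≡⟨ ⋆-cong-≈ g≈g' (λ _ _ → refl) i i≤k ⟨
    (g ⋆ (f /S g)) i   ≡⟨ g⋆[f/g]≗f f g g0≢0 i ⟩
    f i                ≡⟨ f≈f' i i≤k ⟩
    f' i               ∎
    where open ≡-Reasoning

y²/S≗y²·[1/S] : ∀ {Q} → Q 0 ≢ 0ℚ → y² /S Q ≗ y²· (oneS /S Q)
y²/S≗y²·[1/S] {Q} Q0≢0 = sym ∘ /S-unique Q0≢0 Q⋆y²·[1/Q]≗y²
  where
  Q⋆y²·[1/Q]≗y² : Q ⋆ y²· (oneS /S Q) ≗ y²
  Q⋆y²·[1/Q]≗y² i = begin
    (Q ⋆ y²· (oneS /S Q)) i     ≡⟨ ⋆-y²· Q (oneS /S Q) i ⟩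
    (y²· (Q ⋆ (oneS /S Q))) i   ≡⟨ y²·-cong (g⋆[f/g]≗f oneS Q Q0≢0) i ⟩
    (y²· oneS) i                ≡⟨ y²≗y²·oneS i ⟨
    y² i                        ∎
    where open ≡-Reasoning

y²/S-cong-≈ : ∀ {Q Q' k} → Q 0 ≢ 0ℚ → Q ≈[ k ] Q' → y² /S Q ≈[ 2 +ℕ k ] y² /S Q'
y²/S-cong-≈ {Q} {Q'} Q0≢0 Q≈Q' i i≤2+k = begin
  (y² /S Q) i            ≡⟨ y²/S≗y²·[1/S] Q0≢0 i ⟩
  (y²· (oneS /S Q)) i    ≡⟨ y²·-cong-≈ (/S-cong-≈ Q0≢0 (λ _ _ → refl) Q≈Q') i i≤2+k ⟩
  (y²· (oneS /S Q')) i   ≡⟨ y²/S≗y²·[1/S] (Q0≢0 ∘ trans (Q≈Q' 0 z≤n)) i ⟨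
  (y² /S Q') i           ∎
  where open ≡-Reasoning

cf : Series → Series
cf Q = oneS -S (y² /S Q)

cf-constant : ∀ Q → cf Q 0 ≡ 1ℚ
cf-constant Q = cong (1ℚ -ℚ_) (ℚ.*-zeroˡ (invℚ (Q 0)))

cf-cong-≈ : ∀ {Q Q' k} → Q 0 ≢ 0ℚ → Q ≈[ k ] Q' → cf Q ≈[ 2 +ℕ k ] cf Q'
cf-cong-≈ Q0≢0 Q≈Q' i i≤2+k = cong (oneS i -ℚ_) (y²/S-cong-≈ Q0≢0 Q≈Q' i i≤2+k)

IsCfOrbit : (ℕ → Series) → Set
IsCfOrbit X = ∀ m → X (suc m) ≗ cf (X m)

cf-orbit-constant : ∀ {X} → IsCfOrbit X → X 0 0 ≡ 1ℚ → ∀ m → X m 0 ≡ 1ℚ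
cf-orbit-constant     orbit X00≡1 zero    = X00≡1
cf-orbit-constant {X} orbit X00≡1 (suc m) = trans (orbit m 0) (cf-constant (X m))

cf-orbits-agree : ∀ {X Y} → IsCfOrbit X → IsCfOrbit Y → X 0 0 ≡ 1ℚ → Y 0 0 ≡ 1ℚ →
                  ∀ m → X m ≈[ 2 * m ] Y m
cf-orbits-agree orbitX orbitY X00≡1 Y00≡1 zero zero z≤n = trans X00≡1 (sym Y00≡1)
cf-orbits-agree {X} {Y} orbitX orbitY X00≡1 Y00≡1 (suc m) i i≤2+2m = begin
  X (suc m) i      ≡⟨ orbitX m i ⟩
  cf (X m) i       ≡⟨ cf-cong-≈ Xm0≢0 (cf-orbits-agree orbitX orbitY X00≡1 Y00≡1 m) i
                                (subst (i ≤_) (ℕ.*-suc 2 m) i≤2+2m) ⟩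
  cf (Y m) i       ≡⟨ orbitY m i ⟨
  Y (suc m) i      ∎
  where
  open ≡-Reasoning
  Xm0≢0 : X m 0 ≢ 0ℚ
  Xm0≢0 Xm0≡0 with () ← trans (sym (cf-orbit-constant orbitX X00≡1 m)) Xm0≡0

D-isCfOrbit : IsCfOrbit D
D-isCfOrbit m i = refl

D-stable : ∀ {m m'} → m ≤ m' → D m ≈[ 2 * m ] D m'
D-stable {m} m≤m' = go (ℕ.≤⇒≤′ m≤m')
  where
  go : ∀ {m'} → m ≤′ m' → D m ≈[ 2 * m ] D m'
  go ≤′-refl               = λ _ _ → refl
  go (≤′-step {m'} m≤′m') i i≤2m = trans (go m≤′m' i i≤2m)
    (cf-orbits-agree D-isCfOrbit (D-isCfOrbit ∘ suc) refl refl m' i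
       (ℕ.≤-trans i≤2m (ℕ.*-monoʳ-≤ 2 (ℕ.≤′⇒≤ m≤′m'))))

substRecip-suc : ∀ d p i → substRecip (suc d) p (suc i) ≡ substRecip d p i
substRecip-suc d p i with i ≤? d | suc i ≤? suc d
... | yes _   | yes _           = refl
... | no  _   | no  _           = refl
... | yes i≤d | no  1+i≰1+d     = ⊥-elim (1+i≰1+d (s≤s i≤d))
... | no  i≰d | yes (s≤s i≤d)   = ⊥-elim (i≰d i≤d)

substRecip-linear : ∀ d c p q →
  substRecip d (λ k → c *ℚ p k -ℚ q k) ≗ (c ·S substRecip d p) -S substRecip d q
substRecip-linear d c p q i with i ≤? d
... | yes _ = distrib c (p (d ∸ i)) (q (d ∸ i)) (pow2inv (d ∸ i))
  where
  distrib : ∀ c a b w → (c *ℚ a -ℚ b) *ℚ w ≡ c *ℚ (a *ℚ w) -ℚ b *ℚ w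
  distrib = solve 4 (λ c a b w → (c :* a :- b) :* w := c :* (a :* w) :- b :* w) refl
... | no  _ = sym (cong (_-ℚ 0ℚ) (ℚ.*-zeroʳ c))

substRecip-xshift : ∀ d a → substRecip (suc d) (xshift a) ≗ ½ ·S substRecip d a
substRecip-xshift d       a zero          = swap (a d) ½ (pow2inv d)
  where
  swap : ∀ x h w → x *ℚ (h *ℚ w) ≡ h *ℚ (x *ℚ w)
  swap = solve 3 (λ x h w → x :* (h :* w) := h :* (x :* w)) refl
substRecip-xshift zero    a (suc zero)    = refl
substRecip-xshift zero    a (suc (suc i)) = refl
substRecip-xshift (suc d) a (suc i)       = begin
  substRecip (2 +ℕ d) (xshift a) (suc i)   ≡⟨ substRecip-suc (suc d) (xshift a) i ⟩
  substRecip (suc d) (xshift a) i          ≡⟨ substRecip-xshift d a i ⟩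
  ½ *ℚ substRecip d a i                    ≡⟨ cong (½ *ℚ_) (substRecip-suc d a i) ⟨
  ½ *ℚ substRecip (suc d) a (suc i)        ∎
  where open ≡-Reasoning

substRecip-degree : ∀ d b → (∀ k → d < k → b k ≡ 0ℚ) → substRecip (2 +ℕ d) b ≗ y²· substRecip d b
substRecip-degree d b deg zero          =
  trans (cong (_*ℚ pow2inv (2 +ℕ d)) (deg (2 +ℕ d) (ℕ.m<n+m d (s≤s z≤n)))) (ℚ.*-zeroˡ (pow2inv (2 +ℕ d)))
substRecip-degree d b deg (suc zero)    =
  trans (cong (_*ℚ pow2inv (suc d)) (deg (suc d) ℕ.≤-refl)) (ℚ.*-zeroˡ (pow2inv (suc d)))
substRecip-degree d b deg (suc (suc i)) = trans (substRecip-suc (suc d) b (suc i)) (substRecip-suc d b i)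

Tpoly-degree : ∀ n k → n < k → Tpoly n k ≡ 0ℚ
Tpoly-degree zero          (suc k)       _         = refl
Tpoly-degree (suc zero)    (suc zero)    (s≤s ())
Tpoly-degree (suc zero)    (suc (suc k)) _         = refl
Tpoly-degree (suc (suc n)) (suc k)       (s≤s n<k) =
  cong₂ (λ u v → (+ 2 / 1) *ℚ u -ℚ v)
        (Tpoly-degree (suc n) k n<k) (Tpoly-degree n (suc k) (ℕ.m<n⇒m<1+n (ℕ.<-trans (ℕ.n<1+n n) n<k)))

Tʳ : ℕ → Series
Tʳ n = substRecip n (Tpoly n)

Tʳ-recurrence : ∀ n → Tʳ (2 +ℕ n) ≗ Tʳ (suc n) -S y²· Tʳ n
Tʳ-recurrence n i = begin
  Tʳ (2 +ℕ n) i
    ≡⟨ substRecip-linear (2 +ℕ n) two (xshift (Tpoly (suc n))) (Tpoly n) i ⟩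
  two *ℚ substRecip (2 +ℕ n) (xshift (Tpoly (suc n))) i -ℚ substRecip (2 +ℕ n) (Tpoly n) i
    ≡⟨ cong₂ (λ u v → two *ℚ u -ℚ v) (substRecip-xshift (suc n) (Tpoly (suc n)) i)
                                      (substRecip-degree n (Tpoly n) (Tpoly-degree n) i) ⟩
  two *ℚ (½ *ℚ Tʳ (suc n) i) -ℚ (y²· Tʳ n) i
    ≡⟨ cong (_-ℚ (y²· Tʳ n) i) (two-halves (Tʳ (suc n) i)) ⟩
  Tʳ (suc n) i -ℚ (y²· Tʳ n) i ∎
  where
  open ≡-Reasoning
  two = + 2 / 1
  two-halves : ∀ x → two *ℚ (½ *ℚ x) ≡ x
  two-halves x = trans (sym (ℚ.*-assoc two ½ x)) (ℚ.*-identityˡ x)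

Tʳ-constant : ∀ n → Tʳ (suc n) 0 ≡ ½
Tʳ-constant zero    = refl
Tʳ-constant (suc n) = trans (Tʳ-recurrence n 0) (trans (ℚ.+-identityʳ (Tʳ (suc n) 0)) (Tʳ-constant n))

Tʳ-constant≢0 : ∀ n → Tʳ n 0 ≢ 0ℚ
Tʳ-constant≢0 zero    ()
Tʳ-constant≢0 (suc n) Tʳ0≡0 with () ← trans (sym (Tʳ-constant n)) Tʳ0≡0

quotient-recurrence : ∀ {a b c} → b 0 ≢ 0ℚ → c 0 ≢ 0ℚ → a ≗ b -S y²· c → a /S b ≗ cf (b /S c)
quotient-recurrence {a} {b} {c} b0≢0 c0≢0 a≗b-y²c = sym ∘ /S-unique b0≢0 b⋆cf[b/c]≗a
  where
  open ≡-Reasoning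
  q = b /S c
  q0≢0 : q 0 ≢ 0ℚ
  q0≢0 q0≡0 = b0≢0 (begin
    b 0           ≡⟨ g⋆[f/g]≗f b c c0≢0 0 ⟨
    c 0 *ℚ q 0    ≡⟨ cong (c 0 *ℚ_) q0≡0 ⟩
    c 0 *ℚ 0ℚ     ≡⟨ ℚ.*-zeroʳ (c 0) ⟩
    0ℚ            ∎)
  b⋆[y²/q]≗y²·c : b ⋆ (y² /S q) ≗ y²· c
  b⋆[y²/q]≗y²·c i = begin
    (b ⋆ (y² /S q)) i         ≡⟨ ⋆-cong (sym ∘ g⋆[f/g]≗f b c c0≢0) (λ _ → refl) i ⟩
    ((c ⋆ q) ⋆ (y² /S q)) i   ≡⟨ ⋆-assoc c q (y² /S q) i ⟩
    (c ⋆ (q ⋆ (y² /S q))) i   ≡⟨ ⋆-cong (λ _ → refl) (g⋆[f/g]≗f y² q q0≢0) i ⟩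
    (c ⋆ y²) i                ≡⟨ ⋆-y² c i ⟩
    (y²· c) i                 ∎
  b⋆cf[b/c]≗a : b ⋆ cf q ≗ a
  b⋆cf[b/c]≗a i = begin
    (b ⋆ cf q) i                          ≡⟨ ⋆-distribˡ--S b oneS (y² /S q) i ⟩
    (b ⋆ oneS) i -ℚ (b ⋆ (y² /S q)) i     ≡⟨ cong₂ _-ℚ_ (⋆-identityʳ b i) (b⋆[y²/q]≗y²·c i) ⟩
    b i -ℚ (y²· c) i                      ≡⟨ a≗b-y²c i ⟨
    a i                                   ∎

Gn-isCfOrbit : IsCfOrbit (λ m → Gn (2 +ℕ m))
Gn-isCfOrbit m = quotient-recurrence (Tʳ-constant≢0 (2 +ℕ m)) (Tʳ-constant≢0 (suc m)) (Tʳ-recurrence (suc m))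

Gn≈D : ∀ m → Gn (2 +ℕ m) ≈[ 2 * m ] D (suc m)
Gn≈D = cf-orbits-agree Gn-isCfOrbit (D-isCfOrbit ∘ suc) refl refl

proposition2 : (n : ℕ) → 1 < n → (j : ℕ) → j ≤ 2 * n ∸ 4 → G j ≡ Gn n j
proposition2 (suc zero)    (s≤s ()) j
proposition2 (suc (suc m)) _        j j≤2n-4 = begin
  G j                 ≡⟨⟩
  D (suc j) j         ≡⟨ D-stable (s≤s (ℕ.m≤m+n j m)) j (ℕ.≤-trans (ℕ.n≤1+n j) (ℕ.m≤n*m (suc j) 2)) ⟩
  D (suc (j +ℕ m)) j  ≡⟨ D-stable (s≤s (ℕ.m≤n+m m j)) j (ℕ.≤-trans j≤2m (ℕ.*-monoʳ-≤ 2 (ℕ.n≤1+n m))) ⟨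
  D (suc m) j         ≡⟨ Gn≈D m j j≤2m ⟨
  Gn (2 +ℕ m) j       ∎
  where
  open ≡-Reasoning
  2n-4≡2m : 2 * suc (suc m) ∸ 4 ≡ 2 * m
  2n-4≡2m = cong (_∸ 4) (trans (ℕ.*-suc 2 (suc m)) (cong (2 +ℕ_) (ℕ.*-suc 2 m)))
  j≤2m : j ≤ 2 * m
  j≤2m = subst (j ≤_) 2n-4≡2m j≤2n-4
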